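{- Let $r$ be a positive integer, let $d_1,\dots,d_r$ be positive integers, and let $s$ be an integer with $2\leq s\leq r$. Put $c=r-s+1$. Then $$\left(\prod_{1\leq i_1<\dots<i_s\leq r}[d_{i_1},\dots,d_{i_s}]\right)^{1/\binom{r}{s}}\geq \frac{\prod_{i=1}^r d_i^{2/(c+1)}}{\prod_{1\leq i<j\leq r}(d_i,d_j)^{2/(c(c+1))}},$$ where $[\cdot,\dots,\cdot]$ denotes the least common multiple and $(\cdot,\cdot)$ the greatest common divisor. -}

module Defs where

open import Data.Nat using (ℕ; zero; suc; _*_)
open import Data.Nat.GCD using (gcd)
open import Data.Nat.LCM using (lcm)
open import Data.Fin using (Fin)
open import Data.List using (List; []; _∷_; map; _++_; foldr; allFin)
open import Data.Nat.ListAction using (product)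

-- All sublists of length k of a list, keeping the original order.
-- Applied to allFin r = [0,1,...,r-1] this enumerates exactly the
-- index tuples i₁ < i₂ < ... < i_k, each once.
choose : {A : Set} → ℕ → List A → List (List A)
choose zero    xs       = [] ∷ []
choose (suc k) []       = []
choose (suc k) (x ∷ xs) = map (x ∷_) (choose k xs) ++ choose (suc k) xs

lcmList : List ℕ → ℕ
lcmList = foldr lcm 1

gcdList : List ℕ → ℕ
gcdList = foldr gcd 0

prodD : (r : ℕ) → (Fin r → ℕ) → ℕ
prodD r d = product (map d (allFin r))

prodLcm : (r s : ℕ) → (Fin r → ℕ) → ℕ
prodLcm r s d = product (map (λ I → lcmList (map d I)) (choose s (allFin r)))

prodGcd : (r : ℕ) → (Fin r → ℕ) → ℕ
prodGcd r d = product (map (λ I → gcdList (map d I)) (choose 2 (allFin r)))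

{-# OPTIONS --safe #-}
module Submission where

-- Fix a prime p dividing some d_i and write d_i = p^{b_i} y_i with b_i ∈ {0,1}, where b_i = 1
-- exactly when p ∣ d_i. The product of the d_i, each lcm of s of them and each gcd of two of them
-- then split off a power of p whose exponent depends only on the bit pattern b: with K ones and
-- F = r − K zeros, the exponents are K, A = C(r,s) − C(F,s) (the s-sets meeting a one) and
-- B = C(K,2). Since the y_i have a smaller product, induction reduces the theorem to the exponent
-- inequality 2cK·C(r,s) ≤ c(c+1)·A + 2B·C(r,s) for every bit pattern. When F ≥ s it is equivalent
-- to C(F,s)/C(r,s) ≤ (F−s+1)(F−s+2)/(c(c+1)), which holds because the ratios
-- C(s+j+1,s)/C(s+j,s) = (s+j+1)/(j+1) are at least their value (j+3)/(j+1) at s = 2; when F < s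
-- it says (K − c)(K − c − 1) ≥ 0.

open import Data.Bool using (Bool; true; false; not; _∧_; _∨_)
open import Data.Bool.ListAction using (or; and)
open import Data.Fin using (Fin)
open import Data.List using (List; []; _∷_; map; _++_; length; allFin)
open import Data.List.Properties
  using (map-++; map-∘; map-cong; map-cong-local; map-id; length-map; length-++; length-tabulate)
open import Data.List.Relation.Unary.All as All using (All; []; _∷_)
open import Data.List.Relation.Unary.All.Properties using (++⁺; map⁺; ¬Any⇒All¬)
open import Data.List.Relation.Unary.Any using (Any; here; there; any?)
open import Data.Nat
open import Data.Nat.Combinatorics using (_C_; k>n⇒nCk≡0; nCk+nC[k+1]≡[n+1]C[k+1])
open import Data.Nat.Coprimality using (Coprime; coprime-divisor)
open import Data.Nat.Divisibility
open import Data.Nat.GCD using (gcd; gcd-zeroˡ; gcd[m,n]∣m; gcd[m,n]∣n; gcd-greatest; gcd-comm; c*gcd[m,n]≡gcd[cm,cn])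
open import Data.Nat.Induction using (<-wellFounded)
open import Data.Nat.LCM using (lcm; m∣lcm[m,n]; n∣lcm[m,n]; lcm-least; lcm-comm)
open import Data.Nat.ListAction using (sum; product)
open import Data.Nat.ListAction.Properties using (sum-++; product≢0)
open import Data.Nat.Primality using (Prime; prime⇒irreducible; euclidsLemma; prime⇒nonZero; prime⇒nonTrivial)
open import Data.Nat.Primality.Factorisation using (factorise; PrimeFactorisation)
open import Data.Nat.Properties
open import Data.Nat.Tactic.RingSolver using (solve-∀)
open import Data.Product using (_,_; _×_; proj₁; proj₂; ∃)
open import Data.Sum using (inj₁; inj₂)
open import Function using (_∘_; _on_)
open import Induction.WellFounded using (Acc; acc)
open import Relation.Binary.Construct.On as On using ()
open import Relation.Binary.PropositionalEquality
open import Relation.Nullary using (yes; no; ¬_; contradiction)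

open import Defs

[1+n]Ck*[1+n∸k]≡[1+n]*nCk : ∀ n k → (suc n C k) * (suc n ∸ k) ≡ suc n * (n C k)
[1+n]Ck*[1+n∸k]≡[1+n]*nCk n k with k ≤? n
[1+n]Ck*[1+n∸k]≡[1+n]*nCk n k | no k≰n = begin
  (suc n C k) * (suc n ∸ k)  ≡⟨ cong ((suc n C k) *_) (m≤n⇒m∸n≡0 (≰⇒> k≰n)) ⟩
  (suc n C k) * 0            ≡⟨ *-zeroʳ (suc n C k) ⟩
  0                          ≡⟨ *-zeroʳ (suc n) ⟨
  suc n * 0                  ≡⟨ cong (suc n *_) (k>n⇒nCk≡0 (≰⇒> k≰n)) ⟨
  suc n * (n C k)            ∎
  where open ≡-Reasoning
[1+n]Ck*[1+n∸k]≡[1+n]*nCk n zero | yes _ = *-comm 1 (suc n)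
[1+n]Ck*[1+n∸k]≡[1+n]*nCk (suc n) (suc k) | yes (s≤s k≤n) = begin
  (suc N C suc k) * (N ∸ k)
    ≡⟨ cong (_* (N ∸ k)) (nCk+nC[k+1]≡[n+1]C[k+1] N k) ⟨
  (N C k + N C suc k) * (N ∸ k)
    ≡⟨ *-distribʳ-+ (N ∸ k) (N C k) (N C suc k) ⟩
  (N C k) * (N ∸ k) + (N C suc k) * (N ∸ k)
    ≡⟨ cong (λ m → (N C k) * (N ∸ k) + (N C suc k) * m) (+-∸-assoc 1 k≤n) ⟩
  (N C k) * (N ∸ k) + (N C suc k) * suc (N ∸ suc k)
    ≡⟨ cong ((N C k) * (N ∸ k) +_) (*-suc (N C suc k) (N ∸ suc k)) ⟩
  (N C k) * (N ∸ k) + (N C suc k + (N C suc k) * (N ∸ suc k))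
    ≡⟨ cong₂ (λ a b → a + (N C suc k + b)) ([1+n]Ck*[1+n∸k]≡[1+n]*nCk n k) ([1+n]Ck*[1+n∸k]≡[1+n]*nCk n (suc k)) ⟩
  N * (n C k) + (N C suc k + N * (n C suc k))
    ≡⟨ cong (λ b → N * (n C k) + (b + N * (n C suc k))) (nCk+nC[k+1]≡[n+1]C[k+1] n k) ⟨
  N * (n C k) + ((n C k + n C suc k) + N * (n C suc k))
    ≡⟨ regroup N (n C k) (n C suc k) ⟩
  suc N * (n C k + n C suc k)
    ≡⟨ cong (suc N *_) (nCk+nC[k+1]≡[n+1]C[k+1] n k) ⟩
  suc N * (N C suc k) ∎
  where
  open ≡-Reasoning
  N = suc n
  regroup : ∀ N x y → N * x + ((x + y) + N * y) ≡ suc N * (x + y)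
  regroup = solve-∀

length-choose : ∀ {A : Set} k (xs : List A) → length (choose k xs) ≡ length xs C k
length-choose zero    xs       = refl
length-choose (suc k) []       = refl
length-choose (suc k) (x ∷ xs) = begin
  length (map (x ∷_) (choose k xs) ++ choose (suc k) xs)
    ≡⟨ length-++ (map (x ∷_) (choose k xs)) ⟩
  length (map (x ∷_) (choose k xs)) + length (choose (suc k) xs)
    ≡⟨ cong₂ _+_ (trans (length-map (x ∷_) (choose k xs)) (length-choose k xs)) (length-choose (suc k) xs) ⟩
  length xs C k + length xs C suc k
    ≡⟨ nCk+nC[k+1]≡[n+1]C[k+1] (length xs) k ⟩
  suc (length xs) C suc k ∎
  where open ≡-Reasoning

map-choose-map : ∀ {A B C : Set} (g : List B → C) (f : A → B) k xs →
                 map g (choose k (map f xs)) ≡ map (g ∘ map f) (choose k xs)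
map-choose-map g f zero    xs       = refl
map-choose-map g f (suc k) []       = refl
map-choose-map g f (suc k) (x ∷ xs) = begin
  map g (map (f x ∷_) (choose k (map f xs)) ++ choose (suc k) (map f xs))
    ≡⟨ map-++ g (map (f x ∷_) (choose k (map f xs))) (choose (suc k) (map f xs)) ⟩
  map g (map (f x ∷_) (choose k (map f xs))) ++ map g (choose (suc k) (map f xs))
    ≡⟨ cong₂ _++_ (trans (sym (map-∘ (choose k (map f xs)))) (map-choose-map (g ∘ (f x ∷_)) f k xs))
                  (map-choose-map g f (suc k) xs) ⟩
  map (g ∘ map f ∘ (x ∷_)) (choose k xs) ++ map (g ∘ map f) (choose (suc k) xs)
    ≡⟨ cong (_++ map (g ∘ map f) (choose (suc k) xs)) (map-∘ (choose k xs)) ⟩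
  map (g ∘ map f) (map (x ∷_) (choose k xs)) ++ map (g ∘ map f) (choose (suc k) xs)
    ≡⟨ map-++ (g ∘ map f) (map (x ∷_) (choose k xs)) (choose (suc k) xs) ⟨
  map (g ∘ map f) (map (x ∷_) (choose k xs) ++ choose (suc k) xs) ∎
  where open ≡-Reasoning

choose-All : ∀ {A : Set} {P : A → Set} k {xs} → All P xs → All (All P) (choose k xs)
choose-All zero    _          = [] ∷ []
choose-All (suc k) []         = []
choose-All (suc k) (px ∷ pxs) = ++⁺ (map⁺ (All.map (px ∷_) (choose-All k pxs))) (choose-All (suc k) pxs)

sum-map-const : ∀ {A : Set} c (xs : List A) → sum (map (λ _ → c) xs) ≡ c * length xs
sum-map-const c []       = sym (*-zeroʳ c)
sum-map-const c (x ∷ xs) = trans (cong (c +_) (sum-map-const c xs)) (sym (*-suc c (length xs)))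

sum-map-++ : ∀ {A : Set} (f : A → ℕ) xs ys → sum (map f (xs ++ ys)) ≡ sum (map f xs) + sum (map f ys)
sum-map-++ f xs ys = trans (cong sum (map-++ f xs ys)) (sum-++ (map f xs) (map f ys))

bit : Bool → ℕ
bit true  = 1
bit false = 0

trues : List Bool → ℕ
trues bs = sum (map bit bs)

falses : List Bool → ℕ
falses bs = sum (map (bit ∘ not) bs)

hits : ℕ → List Bool → ℕ
hits k bs = sum (map (bit ∘ or) (choose k bs))

truePairs : List Bool → ℕ
truePairs bs = sum (map (bit ∘ and) (choose 2 bs))

trues+falses≡length : ∀ bs → trues bs + falses bs ≡ length bs
trues+falses≡length []           = refl
trues+falses≡length (true ∷ bs)  = cong suc (trues+falses≡length bs)
trues+falses≡length (false ∷ bs) = trans (+-suc (trues bs) (falses bs)) (cong suc (trues+falses≡length bs))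

hits+falsesCk≡lengthCk : ∀ k bs → hits k bs + falses bs C k ≡ length bs C k
hits+falsesCk≡lengthCk zero    bs           = refl
hits+falsesCk≡lengthCk (suc k) []           = refl
hits+falsesCk≡lengthCk (suc k) (true ∷ bs)  = begin
  hits (suc k) (true ∷ bs) + falses bs C suc k
    ≡⟨ cong (_+ falses bs C suc k) (sum-map-++ (bit ∘ or) (map (true ∷_) (choose k bs)) (choose (suc k) bs)) ⟩
  sum (map (bit ∘ or) (map (true ∷_) (choose k bs))) + hits (suc k) bs + falses bs C suc k
    ≡⟨ cong (λ x → x + hits (suc k) bs + falses bs C suc k)
            (trans (cong sum (sym (map-∘ (choose k bs)))) (sum-map-const 1 (choose k bs))) ⟩
  1 * length (choose k bs) + hits (suc k) bs + falses bs C suc k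
    ≡⟨ +-assoc (1 * length (choose k bs)) (hits (suc k) bs) (falses bs C suc k) ⟩
  1 * length (choose k bs) + (hits (suc k) bs + falses bs C suc k)
    ≡⟨ cong₂ _+_ (trans (*-identityˡ _) (length-choose k bs)) (hits+falsesCk≡lengthCk (suc k) bs) ⟩
  length bs C k + length bs C suc k
    ≡⟨ nCk+nC[k+1]≡[n+1]C[k+1] (length bs) k ⟩
  suc (length bs) C suc k ∎
  where open ≡-Reasoning
hits+falsesCk≡lengthCk (suc k) (false ∷ bs) = begin
  hits (suc k) (false ∷ bs) + suc (falses bs) C suc k
    ≡⟨ cong₂ _+_ (sum-map-++ (bit ∘ or) (map (false ∷_) (choose k bs)) (choose (suc k) bs))
                 (sym (nCk+nC[k+1]≡[n+1]C[k+1] (falses bs) k)) ⟩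
  sum (map (bit ∘ or) (map (false ∷_) (choose k bs))) + hits (suc k) bs + (falses bs C k + falses bs C suc k)
    ≡⟨ cong (λ x → x + hits (suc k) bs + (falses bs C k + falses bs C suc k)) (cong sum (sym (map-∘ (choose k bs)))) ⟩
  hits k bs + hits (suc k) bs + (falses bs C k + falses bs C suc k)
    ≡⟨ interchange (hits k bs) (hits (suc k) bs) (falses bs C k) (falses bs C suc k) ⟩
  (hits k bs + falses bs C k) + (hits (suc k) bs + falses bs C suc k)
    ≡⟨ cong₂ _+_ (hits+falsesCk≡lengthCk k bs) (hits+falsesCk≡lengthCk (suc k) bs) ⟩
  length bs C k + length bs C suc k
    ≡⟨ nCk+nC[k+1]≡[n+1]C[k+1] (length bs) k ⟩
  suc (length bs) C suc k ∎
  where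
  open ≡-Reasoning
  interchange : ∀ a b c d → a + b + (c + d) ≡ (a + c) + (b + d)
  interchange = solve-∀

2*truePairs+trues≡trues² : ∀ bs → 2 * truePairs bs + trues bs ≡ trues bs * trues bs
2*truePairs+trues≡trues² []           = refl
2*truePairs+trues≡trues² (false ∷ bs) =
  trans (cong (λ x → 2 * x + trues bs) (sum-map-++ (bit ∘ and) (map (false ∷_) (choose 1 bs)) (choose 2 bs)))
        (trans (cong (λ x → 2 * (x + truePairs bs) + trues bs)
                     (trans (cong sum (sym (map-∘ (choose 1 bs)))) (sum-map-const 0 (choose 1 bs))))
               (2*truePairs+trues≡trues² bs))
2*truePairs+trues≡trues² (true ∷ bs) = begin
  2 * truePairs (true ∷ bs) + suc (trues bs)
    ≡⟨ cong (λ x → 2 * x + suc (trues bs)) (sum-map-++ (bit ∘ and) (map (true ∷_) (choose 1 bs)) (choose 2 bs)) ⟩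
  2 * (sum (map (bit ∘ and) (map (true ∷_) (choose 1 bs))) + truePairs bs) + suc (trues bs)
    ≡⟨ cong (λ x → 2 * (x + truePairs bs) + suc (trues bs)) (trans (cong sum (sym (map-∘ (choose 1 bs)))) (singletons bs)) ⟩
  2 * (trues bs + truePairs bs) + suc (trues bs)
    ≡⟨ regroup (trues bs) (truePairs bs) ⟩
  (2 * truePairs bs + trues bs) + 2 * trues bs + 1
    ≡⟨ cong (λ x → x + 2 * trues bs + 1) (2*truePairs+trues≡trues² bs) ⟩
  trues bs * trues bs + 2 * trues bs + 1
    ≡⟨ square (trues bs) ⟩
  suc (trues bs) * suc (trues bs) ∎
  where
  open ≡-Reasoning
  singletons : ∀ bs → sum (map (bit ∘ and) (choose 1 bs)) ≡ trues bs
  singletons []           = refl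
  singletons (true ∷ bs)  = cong suc (singletons bs)
  singletons (false ∷ bs) = singletons bs
  regroup : ∀ t p → 2 * (t + p) + suc t ≡ (2 * p + t) + 2 * t + 1
  regroup = solve-∀
  square : ∀ t → t * t + 2 * t + 1 ≡ suc t * suc t
  square = solve-∀

pronic : ℕ → ℕ
pronic n = n * suc n

C-ratio-step : ∀ {s} j → 2 ≤ s → ((s + j) C s) * pronic (2 + j) ≤ ((s + suc j) C s) * pronic (suc j)
C-ratio-step {s} j 2≤s = begin
  u * pronic (2 + j)          ≡⟨ rearrange u j ⟩
  (3 + j) * u * (2 + j)       ≤⟨ *-monoˡ-≤ (2 + j) (*-monoˡ-≤ u (+-monoˡ-≤ j (s≤s 2≤s))) ⟩
  (suc s + j) * u * (2 + j)   ≡⟨ cong (_* (2 + j)) absorption ⟨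
  u′ * suc j * (2 + j)        ≡⟨ *-assoc u′ (suc j) (2 + j) ⟩
  u′ * pronic (suc j)         ∎
  where
  open ≤-Reasoning
  u  = (s + j) C s
  u′ = (s + suc j) C s
  rearrange : ∀ u j → u * ((2 + j) * (3 + j)) ≡ (3 + j) * u * (2 + j)
  rearrange = solve-∀
  absorption : u′ * suc j ≡ (suc s + j) * u
  absorption = trans
    (cong₂ (λ n d → (n C s) * d) (+-suc s j) (sym (trans (cong (_∸ s) (sym (+-suc s j))) (m+n∸m≡n s (suc j)))))
    ([1+n]Ck*[1+n∸k]≡[1+n]*nCk (s + j) s)

C-ratio : ∀ {s} j t → 2 ≤ s → ((s + j) C s) * pronic (suc (j + t)) ≤ ((s + (j + t)) C s) * pronic (suc j)
C-ratio j zero 2≤s rewrite +-identityʳ j = ≤-refl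
C-ratio {s} j (suc t) 2≤s rewrite +-suc j t = *-cancelʳ-≤ _ _ (pronic (suc n)) (begin
  a * pronic (2 + n) * pronic (suc n)  ≡⟨ swap a (pronic (2 + n)) (pronic (suc n)) ⟩
  a * pronic (suc n) * pronic (2 + n)  ≤⟨ *-monoˡ-≤ (pronic (2 + n)) (C-ratio j t 2≤s) ⟩
  b * pronic (suc j) * pronic (2 + n)  ≡⟨ swap b (pronic (suc j)) (pronic (2 + n)) ⟩
  b * pronic (2 + n) * pronic (suc j)  ≤⟨ *-monoˡ-≤ (pronic (suc j)) (C-ratio-step n 2≤s) ⟩
  b′ * pronic (suc n) * pronic (suc j) ≡⟨ swap b′ (pronic (suc n)) (pronic (suc j)) ⟩
  b′ * pronic (suc j) * pronic (suc n) ∎)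
  where
  open ≤-Reasoning
  n  = j + t
  a  = (s + j) C s
  b  = (s + n) C s
  b′ = (s + suc n) C s
  swap : ∀ x y z → x * y * z ≡ x * z * y
  swap = solve-∀

layer-bound-manyFalses : ∀ {A B} j K X N → A + N ≡ X → N * pronic (suc (j + K)) ≤ X * pronic (suc j) →
                         2 * B + K ≡ K * K →
                         K * (2 * suc (j + K) * X) ≤ A * pronic (suc (j + K)) + B * (2 * X)
layer-bound-manyFalses {A} {B} j K X N A+N≡X ratio 2B+K≡K² =
  +-cancelʳ-≤ (X * pronic (suc j) + X * K) _ _ (begin
    K * (2 * suc m * X) + (X * pronic (suc j) + X * K) ≡⟨ expand j K X ⟩
    X * P + X * (K * K)                                 ≡⟨ cong₂ (λ a b → a * P + X * b) A+N≡X 2B+K≡K² ⟨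
    (A + N) * P + X * (2 * B + K)                       ≡⟨ regroup A N B K X P ⟩
    A * P + B * (2 * X) + (N * P + X * K)               ≤⟨ +-monoʳ-≤ (A * P + B * (2 * X)) (+-monoˡ-≤ (X * K) ratio) ⟩
    A * P + B * (2 * X) + (X * pronic (suc j) + X * K)  ∎)
  where
  open ≤-Reasoning
  m = j + K
  P = pronic (suc m)
  expand : ∀ j K X → K * (2 * suc (j + K) * X) + (X * (suc j * suc (suc j)) + X * K)
                   ≡ X * (suc (j + K) * suc (suc (j + K))) + X * (K * K)
  expand = solve-∀
  regroup : ∀ A N B K X P → (A + N) * P + X * (2 * B + K) ≡ A * P + B * (2 * X) + (N * P + X * K)
  regroup = solve-∀

layer-bound-fewFalses : ∀ {m K B} X → suc m ≤ K → 2 * B + K ≡ K * K →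
                        K * (2 * suc m * X) ≤ X * pronic (suc m) + B * (2 * X)
layer-bound-fewFalses {m} {K} {B} X m<K 2B+K≡K² with m≤n⇒∃[o]m+o≡n m<K
... | i , refl = +-cancelʳ-≤ (X * K) _ _ (begin
    K * (2 * c * X) + X * K            ≡⟨ expand m i X ⟩
    X * (2 * c * K + c) + X * i        ≤⟨ +-monoʳ-≤ (X * (2 * c * K + c)) (*-monoʳ-≤ X (m≤m*m i)) ⟩
    X * (2 * c * K + c) + X * (i * i)  ≡⟨ complete m i X ⟩
    X * pronic c + X * (K * K)         ≡⟨ cong (λ b → X * pronic c + X * b) 2B+K≡K² ⟨
    X * pronic c + X * (2 * B + K)     ≡⟨ regroup B K X (pronic c) ⟩
    X * pronic c + B * (2 * X) + X * K ∎)
  where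
  open ≤-Reasoning
  c = suc m
  m≤m*m : ∀ m → m ≤ m * m
  m≤m*m zero    = z≤n
  m≤m*m (suc m) = m≤m*n (suc m) (suc m)
  expand : ∀ m i X → (suc m + i) * (2 * suc m * X) + X * (suc m + i) ≡ X * (2 * suc m * (suc m + i) + suc m) + X * i
  expand = solve-∀
  complete : ∀ m i X → X * (2 * suc m * (suc m + i) + suc m) + X * (i * i)
                     ≡ X * (suc m * suc (suc m)) + X * ((suc m + i) * (suc m + i))
  complete = solve-∀
  regroup : ∀ B K X P → X * P + X * (2 * B + K) ≡ X * P + B * (2 * X) + X * K
  regroup = solve-∀

layer-bound : ∀ {s m K F A B} → 2 ≤ s → K + F ≡ s + m → A + F C s ≡ (s + m) C s → 2 * B + K ≡ K * K →
              K * (2 * suc m * ((s + m) C s)) ≤ A * pronic (suc m) + B * (2 * ((s + m) C s))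
layer-bound {s} {m} {K} {F} {A} {B} 2≤s K+F≡s+m A+N≡X 2B+K≡K² with s ≤? F
... | yes s≤F with m≤n⇒∃[o]m+o≡n s≤F
...   | j , refl with +-cancelˡ-≡ s (j + K) m (trans (trans (sym (+-assoc s j K)) (+-comm (s + j) K)) K+F≡s+m)
...     | refl = layer-bound-manyFalses {B = B} j K ((s + m) C s) ((s + j) C s) A+N≡X (C-ratio j K 2≤s) 2B+K≡K²
layer-bound {s} {m} {K} {F} {A} {B} 2≤s K+F≡s+m A+N≡X 2B+K≡K² | no s≰F =
  subst (λ A → K * (2 * suc m * X) ≤ A * pronic (suc m) + B * (2 * X)) X≡A (layer-bound-fewFalses {B = B} X m<K 2B+K≡K²)
  where
  X = (s + m) C s
  X≡A : X ≡ A
  X≡A = trans (sym A+N≡X) (trans (cong (A +_) (k>n⇒nCk≡0 (≰⇒> s≰F))) (+-identityʳ A))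
  m<K : suc m ≤ K
  m<K = ≰⇒> λ K≤m → <-irrefl K+F≡s+m (subst (K + F <_) (+-comm m s) (+-mono-≤-< K≤m (≰⇒> s≰F)))

pattern-bound : ∀ {r s} → 2 ≤ s → s ≤ r → ∀ bs → length bs ≡ r →
                trues bs * (2 * suc (r ∸ s) * (r C s)) ≤ hits s bs * pronic (suc (r ∸ s)) + truePairs bs * (2 * (r C s))
pattern-bound {r} {s} 2≤s s≤r bs refl =
  subst (λ n → trues bs * (2 * suc m * (n C s)) ≤ hits s bs * pronic (suc m) + truePairs bs * (2 * (n C s)))
        s+m≡r
        (layer-bound {B = truePairs bs} 2≤s (trans (trues+falses≡length bs) (sym s+m≡r))
                     (trans (hits+falsesCk≡lengthCk s bs) (cong (_C s) (sym s+m≡r)))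
                     (2*truePairs+trues≡trues² bs))
  where
  m = r ∸ s
  s+m≡r : s + m ≡ r
  s+m≡r = m+[n∸m]≡n s≤r

gcd[cm,n]≡gcd[m,n] : ∀ {c} m n → Coprime c n → gcd (c * m) n ≡ gcd m n
gcd[cm,n]≡gcd[m,n] {c} m n c⊥n = ∣-antisym
  (gcd-greatest (coprime-divisor g⊥c (gcd[m,n]∣m (c * m) n)) (gcd[m,n]∣n (c * m) n))
  (gcd-greatest (∣-trans (gcd[m,n]∣m m n) (n∣m*n c)) (gcd[m,n]∣n m n))
  where
  g⊥c : Coprime (gcd (c * m) n) c
  g⊥c (d∣g , d∣c) = c⊥n (d∣c , ∣-trans d∣g (gcd[m,n]∣n (c * m) n))

lcm[cm,n]≡c*lcm[m,n] : ∀ {c} m n .{{_ : NonZero c}} → Coprime c n → lcm (c * m) n ≡ c * lcm m n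
lcm[cm,n]≡c*lcm[m,n] {c} m n c⊥n with ∣-trans (m∣m*n m) (m∣lcm[m,n] (c * m) n)
... | divides q l≡qc = ∣-antisym
  (lcm-least (*-monoʳ-∣ c (m∣lcm[m,n] m n)) (∣n⇒∣m*n c (n∣lcm[m,n] m n)))
  (subst (c * lcm m n ∣_) (sym l≡cq) (*-monoʳ-∣ c (lcm-least m∣q n∣q)))
  where
  l≡cq : lcm (c * m) n ≡ c * q
  l≡cq = trans l≡qc (*-comm q c)
  m∣q : m ∣ q
  m∣q = *-cancelˡ-∣ c (subst (c * m ∣_) l≡cq (m∣lcm[m,n] (c * m) n))
  n∣q : n ∣ q
  n∣q = coprime-divisor (λ (d∣n , d∣c) → c⊥n (d∣c , d∣n)) (subst (n ∣_) l≡cq (n∣lcm[m,n] (c * m) n))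

c*lcm[m,n]≡lcm[cm,cn] : ∀ c m n .{{_ : NonZero c}} → c * lcm m n ≡ lcm (c * m) (c * n)
c*lcm[m,n]≡lcm[cm,cn] c m n with ∣-trans (m∣m*n m) (m∣lcm[m,n] (c * m) (c * n))
... | divides q l≡qc = ∣-antisym
  (subst (c * lcm m n ∣_) (sym l≡cq) (*-monoʳ-∣ c (lcm-least m∣q n∣q)))
  (lcm-least (*-monoʳ-∣ c (m∣lcm[m,n] m n)) (*-monoʳ-∣ c (n∣lcm[m,n] m n)))
  where
  l≡cq : lcm (c * m) (c * n) ≡ c * q
  l≡cq = trans l≡qc (*-comm q c)
  m∣q : m ∣ q
  m∣q = *-cancelˡ-∣ c (subst (c * m ∣_) l≡cq (m∣lcm[m,n] (c * m) (c * n)))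
  n∣q : n ∣ q
  n∣q = *-cancelˡ-∣ c (subst (c * n ∣_) l≡cq (n∣lcm[m,n] (c * m) (c * n)))

scaleIf : ℕ → Bool → ℕ → ℕ
scaleIf p true  y = p * y
scaleIf p false y = y

unpeel : ℕ → Bool × ℕ → ℕ
unpeel p z = scaleIf p (proj₁ z) (proj₂ z)

-- A pair (b , y) stands for p^b · y; it is peeled when a false bit is only used for y with p ∤ y,
-- so that the bit records whether p divides the number represented.
Peeled : ℕ → Bool × ℕ → Set
Peeled p z = proj₁ z ≡ false → p ∤ proj₂ z

peel : ℕ → ℕ → Bool × ℕ
peel p x with p ∣? x
... | yes (divides q _) = true , q
... | no  _             = false , x

unpeel-peel : ∀ p x → unpeel p (peel p x) ≡ x
unpeel-peel p x with p ∣? x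
... | yes (divides q x≡qp) = trans (*-comm p q) (sym x≡qp)
... | no  _                = refl

peeled-peel : ∀ p x → Peeled p (peel p x)
peeled-peel p x with p ∣? x
... | yes _   = λ ()
... | no  p∤x = λ _ → p∤x

peel-nonZero : ∀ p x → NonZero x → NonZero (proj₂ (peel p x))
peel-nonZero p x x≢0 with p ∣? x
... | yes (divides q refl) = m*n≢0⇒m≢0 q {{x≢0}}
... | no  _                = x≢0

peel-divisor : ∀ {p x} → p ∣ x → proj₁ (peel p x) ≡ true
peel-divisor {p} {x} p∣x with p ∣? x
... | yes _   = refl
... | no  p∤x = contradiction p∣x p∤x

1≤trues-peel : ∀ {p xs} → Any (p ∣_) xs → 1 ≤ trues (map proj₁ (map (peel p) xs))
1≤trues-peel (here p∣x) rewrite peel-divisor p∣x = s≤s z≤n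
1≤trues-peel {p} {x ∷ _} (there any) = ≤-trans (1≤trues-peel any) (m≤n+m _ (bit (proj₁ (peel p x))))

module _ {p} (p-prime : Prime p) where

  instance
    p≢0 : NonZero p
    p≢0 = prime⇒nonZero p-prime

  p∤⇒coprime : ∀ {n} → p ∤ n → Coprime p n
  p∤⇒coprime p∤n (d∣p , d∣n) with prime⇒irreducible p-prime d∣p
  ... | inj₁ d≡1 = d≡1
  ... | inj₂ d≡p = contradiction (subst (_∣ _) d≡p d∣n) p∤n

  p∤1 : p ∤ 1
  p∤1 p∣1 = <⇒≱ (nonTrivial⇒n>1 p {{prime⇒nonTrivial p-prime}}) (∣⇒≤ p∣1)

  p∤lcm : ∀ {m n} → p ∤ m → p ∤ n → p ∤ lcm m n
  p∤lcm {m} {n} p∤m p∤n p∣l with euclidsLemma m n p-prime (∣-trans p∣l (lcm-least (m∣m*n {m} n) (n∣m*n m {n})))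
  ... | inj₁ p∣m = p∤m p∣m
  ... | inj₂ p∣n = p∤n p∣n

  peeled-lcm : ∀ {a b y z} → Peeled p (a , y) → Peeled p (b , z) → Peeled p (a ∨ b , lcm y z)
  peeled-lcm {false} {false} p∤y p∤z _ = p∤lcm (p∤y refl) (p∤z refl)
  peeled-lcm {false} {true}  _   _   ()
  peeled-lcm {true}          _   _   ()

  peeled-gcd : ∀ {a b y z} → Peeled p (a , y) → Peeled p (b , z) → Peeled p (a ∧ b , gcd y z)
  peeled-gcd {false} {_}     {y} {z} p∤y _   _ p∣g = p∤y refl (∣-trans p∣g (gcd[m,n]∣m y z))
  peeled-gcd {true}  {false} {y} {z} _   p∤z _ p∣g = p∤z refl (∣-trans p∣g (gcd[m,n]∣n y z))
  peeled-gcd {true}  {true}          _   _   ()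

  lcm-scaleIf : ∀ {a b y z} → Peeled p (a , y) → Peeled p (b , z) →
                lcm (scaleIf p a y) (scaleIf p b z) ≡ scaleIf p (a ∨ b) (lcm y z)
  lcm-scaleIf {true}  {true}  {y} {z} _   _   = sym (c*lcm[m,n]≡lcm[cm,cn] p y z)
  lcm-scaleIf {true}  {false} {y} {z} _   p∤z = lcm[cm,n]≡c*lcm[m,n] y z (p∤⇒coprime (p∤z refl))
  lcm-scaleIf {false} {true}  {y} {z} p∤y _   = begin
    lcm y (p * z)  ≡⟨ lcm-comm y (p * z) ⟩
    lcm (p * z) y  ≡⟨ lcm[cm,n]≡c*lcm[m,n] z y (p∤⇒coprime (p∤y refl)) ⟩
    p * lcm z y    ≡⟨ cong (p *_) (lcm-comm z y) ⟩
    p * lcm y z    ∎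
    where open ≡-Reasoning
  lcm-scaleIf {false} {false} _ _ = refl

  gcd-scaleIf : ∀ {a b y z} → Peeled p (a , y) → Peeled p (b , z) →
                gcd (scaleIf p a y) (scaleIf p b z) ≡ scaleIf p (a ∧ b) (gcd y z)
  gcd-scaleIf {true}  {true}  {y} {z} _   _   = sym (c*gcd[m,n]≡gcd[cm,cn] p y z)
  gcd-scaleIf {true}  {false} {y} {z} _   p∤z = gcd[cm,n]≡gcd[m,n] y z (p∤⇒coprime (p∤z refl))
  gcd-scaleIf {false} {true}  {y} {z} p∤y _   = begin
    gcd y (p * z)  ≡⟨ gcd-comm y (p * z) ⟩
    gcd (p * z) y  ≡⟨ gcd[cm,n]≡gcd[m,n] z y (p∤⇒coprime (p∤y refl)) ⟩
    gcd z y        ≡⟨ gcd-comm z y ⟩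
    gcd y z        ∎
    where open ≡-Reasoning
  gcd-scaleIf {false} {false} _ _ = refl

  peeled-lcmList : ∀ {zs} → All (Peeled p) zs → Peeled p (or (map proj₁ zs) , lcmList (map proj₂ zs))
  peeled-lcmList []          _ = p∤1
  peeled-lcmList (pz ∷ pzs)    = peeled-lcm pz (peeled-lcmList pzs)

  peeled-gcdList : ∀ {zs} → All (Peeled p) zs → Peeled p (and (map proj₁ zs) , gcdList (map proj₂ zs))
  peeled-gcdList []         ()
  peeled-gcdList (pz ∷ pzs) = peeled-gcd pz (peeled-gcdList pzs)

  lcmList-unpeel : ∀ {zs} → All (Peeled p) zs →
                   lcmList (map (unpeel p) zs) ≡ scaleIf p (or (map proj₁ zs)) (lcmList (map proj₂ zs))
  lcmList-unpeel []                = refl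
  lcmList-unpeel {z ∷ _} (pz ∷ pzs) = trans (cong (lcm (unpeel p z)) (lcmList-unpeel pzs)) (lcm-scaleIf pz (peeled-lcmList pzs))

  gcdList-unpeel : ∀ {zs} → All (Peeled p) zs →
                   gcdList (map (unpeel p) zs) ≡ scaleIf p (and (map proj₁ zs)) (gcdList (map proj₂ zs))
  gcdList-unpeel []                = sym (*-zeroʳ p)
  gcdList-unpeel {z ∷ _} (pz ∷ pzs) = trans (cong (gcd (unpeel p z)) (gcdList-unpeel pzs)) (gcd-scaleIf pz (peeled-gcdList pzs))

lcmProduct : ℕ → List ℕ → ℕ
lcmProduct k xs = product (map lcmList (choose k xs))

gcdProduct : List ℕ → ℕ
gcdProduct xs = product (map gcdList (choose 2 xs))

product-scaleIf : ∀ {A : Set} p (a : A → Bool) (g : A → ℕ) xs →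
                  product (map (λ x → scaleIf p (a x) (g x)) xs) ≡ p ^ sum (map (bit ∘ a) xs) * product (map g xs)
product-scaleIf p a g []       = refl
product-scaleIf p a g (x ∷ xs) =
  trans (cong (scaleIf p (a x) (g x) *_) (product-scaleIf p a g xs)) (pull (a x))
  where
  S = sum (map (bit ∘ a) xs)
  G = product (map g xs)
  swap₁ : ∀ p y P G → p * y * (P * G) ≡ p * P * (y * G)
  swap₁ = solve-∀
  swap₂ : ∀ y P G → y * (P * G) ≡ P * (y * G)
  swap₂ = solve-∀
  pull : ∀ b → scaleIf p b (g x) * (p ^ S * G) ≡ p ^ (bit b + S) * (g x * G)
  pull true  = swap₁ p (g x) (p ^ S) G
  pull false = swap₂ (g x) (p ^ S) G

product-unpeel : ∀ p zs → product (map (unpeel p) zs) ≡ p ^ trues (map proj₁ zs) * product (map proj₂ zs)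
product-unpeel p zs = trans (product-scaleIf p proj₁ proj₂ zs)
                            (cong (λ e → p ^ e * product (map proj₂ zs)) (cong sum (map-∘ zs)))

product-choose-unpeel : ∀ {p} (F : List ℕ → ℕ) (a : List Bool → Bool) k {zs} →
  (∀ {I} → All (Peeled p) I → F (map (unpeel p) I) ≡ scaleIf p (a (map proj₁ I)) (F (map proj₂ I))) →
  All (Peeled p) zs →
  product (map F (choose k (map (unpeel p) zs)))
    ≡ p ^ sum (map (bit ∘ a) (choose k (map proj₁ zs))) * product (map F (choose k (map proj₂ zs)))
product-choose-unpeel {p} F a k {zs} F-unpeel pzs = begin
  product (map F (choose k (map (unpeel p) zs)))
    ≡⟨ cong product (map-choose-map F (unpeel p) k zs) ⟩
  product (map (F ∘ map (unpeel p)) (choose k zs))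
    ≡⟨ cong product (map-cong-local (All.map F-unpeel (choose-All k pzs))) ⟩
  product (map (λ I → scaleIf p (a (map proj₁ I)) (F (map proj₂ I))) (choose k zs))
    ≡⟨ product-scaleIf p (a ∘ map proj₁) (F ∘ map proj₂) (choose k zs) ⟩
  p ^ sum (map (bit ∘ a ∘ map proj₁) (choose k zs)) * product (map (F ∘ map proj₂) (choose k zs))
    ≡⟨ cong₂ (λ e P → p ^ e * P) (cong sum (map-choose-map (bit ∘ a) proj₁ k zs))
                                  (cong product (map-choose-map F proj₂ k zs)) ⟨
  p ^ sum (map (bit ∘ a) (choose k (map proj₁ zs))) * product (map F (choose k (map proj₂ zs))) ∎
  where open ≡-Reasoning

[m*n]^o≡m^o*n^o : ∀ m n o → (m * n) ^ o ≡ m ^ o * n ^ o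
[m*n]^o≡m^o*n^o m n zero    = refl
[m*n]^o≡m^o*n^o m n (suc o) = trans (cong (m * n *_) ([m*n]^o≡m^o*n^o m n o)) (interchange m n (m ^ o) (n ^ o))
  where
  interchange : ∀ a b c d → a * b * (c * d) ≡ a * c * (b * d)
  interchange = solve-∀

[p^a*x]^e≡p^[a*e]*x^e : ∀ p a x e → (p ^ a * x) ^ e ≡ p ^ (a * e) * x ^ e
[p^a*x]^e≡p^[a*e]*x^e p a x e = trans ([m*n]^o≡m^o*n^o (p ^ a) x e) (cong (_* x ^ e) (^-*-assoc p a e))

layer-combine : ∀ p {K A B E₁ E₂ E₃ P L G} .{{_ : NonZero p}} →
                K * E₁ ≤ A * E₂ + B * E₃ → P ^ E₁ ≤ L ^ E₂ * G ^ E₃ →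
                (p ^ K * P) ^ E₁ ≤ (p ^ A * L) ^ E₂ * (p ^ B * G) ^ E₃
layer-combine p {K} {A} {B} {E₁} {E₂} {E₃} {P} {L} {G} exponents rest = begin
  (p ^ K * P) ^ E₁                                   ≡⟨ [p^a*x]^e≡p^[a*e]*x^e p K P E₁ ⟩
  p ^ (K * E₁) * P ^ E₁                              ≤⟨ *-mono-≤ (^-monoʳ-≤ p exponents) rest ⟩
  p ^ (A * E₂ + B * E₃) * (L ^ E₂ * G ^ E₃)           ≡⟨ cong (_* (L ^ E₂ * G ^ E₃)) (^-distribˡ-+-* p (A * E₂) (B * E₃)) ⟩
  p ^ (A * E₂) * p ^ (B * E₃) * (L ^ E₂ * G ^ E₃)     ≡⟨ interchange (p ^ (A * E₂)) (p ^ (B * E₃)) (L ^ E₂) (G ^ E₃) ⟩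
  p ^ (A * E₂) * L ^ E₂ * (p ^ (B * E₃) * G ^ E₃)     ≡⟨ cong₂ _*_ ([p^a*x]^e≡p^[a*e]*x^e p A L E₂) ([p^a*x]^e≡p^[a*e]*x^e p B G E₃) ⟨
  (p ^ A * L) ^ E₂ * (p ^ B * G) ^ E₃ ∎
  where
  open ≤-Reasoning
  interchange : ∀ a b c d → a * b * (c * d) ≡ a * c * (b * d)
  interchange = solve-∀

prime-divisor : ∀ {n} → 2 ≤ n → ∃ λ p → Prime p × p ∣ n
prime-divisor {n} 2≤n = divisor (PrimeFactorisation.factors F) (PrimeFactorisation.isFactorisation F)
                               (PrimeFactorisation.factorsPrime F)
  where
  instance _ = >-nonZero (≤-trans (s≤s z≤n) 2≤n)
  F = factorise n
  divisor : ∀ ps → n ≡ product ps → All Prime ps → ∃ λ p → Prime p × p ∣ n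
  divisor []       n≡1 _             = contradiction (subst (2 ≤_) n≡1 2≤n) λ { (s≤s ()) }
  divisor (p ∷ ps) n≡p*Π (p-prime ∷ _) = p , p-prime , subst (p ∣_) (sym n≡p*Π) (m∣m*n (product ps))

prime-divisor-any : ∀ {xs} → Any (2 ≤_) xs → ∃ λ p → Prime p × Any (p ∣_) xs
prime-divisor-any (here 2≤x) with prime-divisor 2≤x
... | p , p-prime , p∣x = p , p-prime , here p∣x
prime-divisor-any (there any) with prime-divisor-any any
... | p , p-prime , p∣xs = p , p-prime , there p∣xs

lcmList-ones : ∀ {xs} → All (_≡ 1) xs → lcmList xs ≡ 1
lcmList-ones []            = refl
lcmList-ones (refl ∷ ones) rewrite lcmList-ones ones = refl

gcdList-choose-ones : ∀ k {xs} → All (_≡ 1) xs → All (λ I → gcdList I ≡ 1) (choose (suc k) xs)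
gcdList-choose-ones k []            = []
gcdList-choose-ones k (refl ∷ ones) =
  ++⁺ (map⁺ (All.universal (λ I → gcd-zeroˡ (gcdList I)) (choose k _))) (gcdList-choose-ones k ones)

product-ones : ∀ {xs} → All (_≡ 1) xs → product xs ≡ 1
product-ones []            = refl
product-ones (refl ∷ ones) = trans (+-identityʳ _) (product-ones ones)

peel-layer : ∀ {p k E₁ E₂ E₃ zs} → Prime p → All (Peeled p) zs →
  trues (map proj₁ zs) * E₁ ≤ hits k (map proj₁ zs) * E₂ + truePairs (map proj₁ zs) * E₃ →
  product (map proj₂ zs) ^ E₁ ≤ lcmProduct k (map proj₂ zs) ^ E₂ * gcdProduct (map proj₂ zs) ^ E₃ →
  product (map (unpeel p) zs) ^ E₁ ≤ lcmProduct k (map (unpeel p) zs) ^ E₂ * gcdProduct (map (unpeel p) zs) ^ E₃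
peel-layer {p} {k} {E₁} {E₂} {E₃} {zs} p-prime pzs bits-bound rest
  rewrite product-unpeel p zs
        | product-choose-unpeel lcmList or k (lcmList-unpeel p-prime) pzs
        | product-choose-unpeel gcdList and 2 (gcdList-unpeel p-prime) pzs
  = layer-combine p {trues bits} {hits k bits} {truePairs bits} {E₁} {E₂} {E₃}
                    {product ys} {lcmProduct k ys} {gcdProduct ys} {{prime⇒nonZero p-prime}} bits-bound rest
  where
  bits = map proj₁ zs
  ys   = map proj₂ zs

layer-reduction : ∀ {r} k {E₁ E₂ E₃} →
  (∀ bs → length bs ≡ r → trues bs * E₁ ≤ hits k bs * E₂ + truePairs bs * E₃) →
  ∀ xs → length xs ≡ r → All NonZero xs → product xs ^ E₁ ≤ lcmProduct k xs ^ E₂ * gcdProduct xs ^ E₃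
layer-reduction {r} k {E₁} {E₂} {E₃} bound xs = go xs (On.wellFounded product <-wellFounded xs)
  where
  Goal : List ℕ → Set
  Goal xs = product xs ^ E₁ ≤ lcmProduct k xs ^ E₂ * gcdProduct xs ^ E₃

  ones-goal : ∀ {xs} → All (_≡ 1) xs → Goal xs
  ones-goal ones rewrite product-ones ones
                       | product-ones (map⁺ (All.map lcmList-ones (choose-All k ones)))
                       | product-ones (map⁺ (gcdList-choose-ones 1 ones))
                       | ^-zeroˡ E₁ | ^-zeroˡ E₂ | ^-zeroˡ E₃ = ≤-refl

  ≡1 : ∀ {x} → NonZero x × ¬ 2 ≤ x → x ≡ 1
  ≡1 {suc zero}    _         = refl
  ≡1 {suc (suc _)} (_ , ≱2) = contradiction (s≤s (s≤s z≤n)) ≱2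

  go : ∀ xs → Acc (_<_ on product) xs → length xs ≡ r → All NonZero xs → Goal xs
  go xs (acc rec) len nz with any? (2 ≤?_) xs
  ... | no ¬big = ones-goal (All.zipWith ≡1 (nz , ¬Any⇒All¬ xs ¬big))
  ... | yes big with prime-divisor-any big
  ...   | p , p-prime , p∣xs = subst Goal unpeel∘peel
          (peel-layer {k = k} {E₁} {E₂} {E₃} p-prime (map⁺ (All.universal (peeled-peel p) xs))
                      (bound bits (trans (length-map proj₁ zs) (trans (length-map (peel p) xs) len)))
                      (go ys (rec ys<xs) (trans (length-map proj₂ zs) (trans (length-map (peel p) xs) len)) ys≢0))
    where
    zs   = map (peel p) xs
    bits = map proj₁ zs
    ys   = map proj₂ zs
    ys≢0 : All NonZero ys
    ys≢0 = map⁺ (map⁺ (All.map (λ {x} → peel-nonZero p x) nz))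
    unpeel∘peel : map (unpeel p) zs ≡ xs
    unpeel∘peel = trans (sym (map-∘ xs)) (trans (map-cong (unpeel-peel p) xs) (map-id xs))
    1<p^K : 1 < p ^ trues bits
    1<p^K = ^-monoʳ-< p (nonTrivial⇒n>1 p {{prime⇒nonTrivial p-prime}}) (1≤trues-peel p∣xs)
    ys<xs : product ys < product xs
    ys<xs = begin-strict
      product ys                    <⟨ m<m*n (product ys) (p ^ trues bits) {{product≢0 ys≢0}} 1<p^K ⟩
      product ys * p ^ trues bits   ≡⟨ *-comm (product ys) (p ^ trues bits) ⟩
      p ^ trues bits * product ys   ≡⟨ product-unpeel p zs ⟨
      product (map (unpeel p) zs)   ≡⟨ cong product unpeel∘peel ⟩
      product xs                    ∎
      where open ≤-Reasoning

lemma3p2 : (r : ℕ) → 1 ≤ r → (d : Fin r → ℕ) → (∀ i → 1 ≤ d i) →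
           (s : ℕ) → 2 ≤ s → s ≤ r →
           prodD r d ^ (2 * suc (r ∸ s) * (r C s))
             ≤ prodLcm r s d ^ (suc (r ∸ s) * suc (suc (r ∸ s))) * prodGcd r d ^ (2 * (r C s))
-- The hypothesis 1 ≤ r is implied by 2 ≤ s ≤ r.
lemma3p2 r _ d d≥1 s 2≤s s≤r =
  subst₂ (λ L G → prodD r d ^ (2 * suc (r ∸ s) * (r C s)) ≤ L ^ (suc (r ∸ s) * suc (suc (r ∸ s))) * G ^ (2 * (r C s)))
         (cong product (map-choose-map lcmList d s (allFin r)))
         (cong product (map-choose-map gcdList d 2 (allFin r)))
         (layer-reduction s (pattern-bound 2≤s s≤r) (map d (allFin r))
                          (trans (length-map d (allFin r)) (length-tabulate (λ i → i)))
                          (map⁺ (All.universal (λ i → >-nonZero (d≥1 i)) (allFin r))))
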